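{- Let $L,n$ be positive integers and $B\in\mathcal M(L,n)$. Then \[\rho_N(B)=e^\star_{[L-1,L-1]}\,e^\star_{[L-2,L-1]}\cdots e^\star_{[2,L-1]}\,e^\star_{[1,L-1]}(B).\]
   Context: $\mathcal M(L,n)$ is the set of tuples $B=(B_1,\dots,B_L)$ of subsets of $\{1,\dots,n\}$, drawn with rows $1..L$ bottom to top and columns $1..n$ left to right, a ball at $(r,j)$ iff $j\in B_r$. The column word $\mathrm{cw}(B)$ records row numbers of balls scanning columns left to right, each column top to bottom. For $i\ge1$, $\mathrm{Par}_i(w)$ writes "(" for each letter $i+1$ and ")" for each letter $i$ of $w$ (read left to right) and matches parentheses iteratively when an "(" is immediately followed by ")" or separated from it only by matched parentheses; a ball of row $i+1$ is unmatched above if its letter is unmatched in $\mathrm{Par}_i(\mathrm{cw}(B))$. $e_i^\star$ moves every ball of row $i+1$ that is unmatched above to row $i$ in the same column. Operators compose right to left and $e^\star_{[a,b]}=e^\star_ae^\star_{a+1}\cdots e^\star_b$ for $a\le b$ (so $e^\star_b$ acts first). The collapsing is $\rho_N(B)=e^\star_{[1,L-1]}e^\star_{[1,L-2]}\cdots e^\star_{[1,1]}(B)$. -}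

module Defs where

open import Data.Nat using (ℕ; zero; suc; _≡ᵇ_; _∸_)
open import Data.Bool using (Bool; true; false; if_then_else_; _∧_; not)
open import Data.List using (List; []; _∷_; _++_; concatMap; reverse)
open import Data.Bool.ListAction using (any)
open import Data.Vec using (Vec; []; _∷_; tabulate)
open import Data.Fin using (Fin; toℕ)
open import Data.Product using (_×_; _,_)

-- M(L,n): an L-tuple of subsets of {1..n}, each subset given by its
-- characteristic vector in Vec Bool n.  Row r (1 ≤ r ≤ L) is the
-- (r-1)-th entry; column j (1 ≤ j ≤ n) is the (j-1)-th Fin n; a ball at (r,j)
-- iff the corresponding Bool is true.
M : ℕ → ℕ → Set
M L n = Vec (Vec Bool n) L

-- ball at (row r, column index j), rows numbered from 1; out of range = no ball
ball : ∀ {L n} → M L n → ℕ → Fin n → Bool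
ball []       _             _ = false
ball (_ ∷ _)  zero          _ = false
ball (R ∷ _)  (suc zero)    j = Data.Vec.lookup R j
ball (_ ∷ Bs) (suc (suc r)) j = ball Bs (suc r) j

rowsDown : ℕ → List ℕ
rowsDown zero    = []
rowsDown (suc k) = suc k ∷ rowsDown k

allFinL : ∀ n → List (Fin n)
allFinL n = Data.Vec.toList (tabulate (λ j → j))

cwTagged : ∀ {L n} → M L n → List (ℕ × Fin n)
cwTagged {L} {n} B =
  concatMap (λ j → concatMap (λ r → if ball B r j then (r , j) ∷ [] else [])
                             (rowsDown L))
            (allFinL n)

cw : ∀ {L n} → M L n → List ℕ
cw B = Data.List.map (λ p → Data.Product.proj₁ p) (cwTagged B)

-- Par_i matching by the standard stack procedure (equivalent to iterated
-- cancellation of adjacent "()" pairs): scan left to right, push every "("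
-- (letter i+1), and let every ")" (letter i) cancel the most recent unmatched
-- "(" if there is one.  Returns the columns of the unmatched "(" letters.
unmatchedOpen : ∀ {n} → ℕ → List (ℕ × Fin n) → List (Fin n) → List (Fin n)
unmatchedOpen i []             stack = stack
unmatchedOpen i ((r , j) ∷ w) stack =
  if r ≡ᵇ suc i then unmatchedOpen i w (j ∷ stack)
  else if r ≡ᵇ i then (popOne stack)
  else unmatchedOpen i w stack
  where
  popOne : List _ → List _
  popOne []      = unmatchedOpen i w []
  popOne (_ ∷ s) = unmatchedOpen i w s

finEq : ∀ {n} → Fin n → Fin n → Bool
finEq a b = toℕ a ≡ᵇ toℕ b

unmatchedAbove : ∀ {L n} → ℕ → M L n → Fin n → Bool
unmatchedAbove i B j = any (finEq j) (unmatchedOpen i (cwTagged B) [])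

estar : ∀ {L n} → ℕ → M L n → M L n
estar {L} {n} i B = tabulate (λ k → tabulate (newRow k))
  where
  U : Fin n → Bool
  U = unmatchedAbove i B
  newRow : Fin L → Fin n → Bool
  newRow k j =
    let r = suc (toℕ k) in
    if r ≡ᵇ i then (ball B r j Data.Bool.∨ U j)
    else if r ≡ᵇ suc i then (ball B r j ∧ not (U j))
    else ball B r j

-- e*_{[a,b]} = e*_a e*_{a+1} ... e*_b  (e*_b acts first); identity if a > b.
estarSegLen : ∀ {L n} → ℕ → ℕ → M L n → M L n
estarSegLen a zero    B = B
estarSegLen a (suc k) B = estarSegLen a k (estar (a Data.Nat.+ k) B)

estarInt : ∀ {L n} → ℕ → ℕ → M L n → M L n
estarInt a b = estarSegLen a (suc b ∸ a)

-- ρ_N(B) = e*_{[1,L-1]} e*_{[1,L-2]} ... e*_{[1,1]} (B)   (e*_{[1,1]} first)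
-- rhoAux m B = e*_{[1,m]} ... e*_{[1,1]} (B)
rhoAux : ∀ {L n} → ℕ → M L n → M L n
rhoAux zero    B = B
rhoAux (suc m) B = estarInt 1 (suc m) (rhoAux m B)

rhoN : ∀ {L n} → M L n → M L n
rhoN {L} B = rhoAux (L ∸ 1) B

-- e*_{[L-1,L-1]} e*_{[L-2,L-1]} ... e*_{[1,L-1]} (B)  (e*_{[1,L-1]} first)
-- rhsAux a B = e*_{[L-1,L-1]} ... e*_{[a,L-1]} (B) for 1 ≤ a; fuel = L-a
rhsAux : ∀ {L n} → ℕ → ℕ → M L n → M L n
rhsAux {L} a zero       B = B
rhsAux {L} a (suc fuel) B = rhsAux (suc a) fuel (estarInt a (L ∸ 1) B)

rhsN : ∀ {L n} → M L n → M L n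
rhsN {L} B = rhsAux 1 (L ∸ 1) B

-- Cut B into its columns.  Reading the column word from the right, e*_i lowers the ball of
-- row i+1 in a column exactly when no ball of row i at or to the right of it is still free,
-- so e*_i is a transducer on the list of columns whose state is the number of free balls of
-- row i.  Operators on rows at distance at least two commute, since they read and move
-- disjoint rows.  For the braid relation e*_1 e*_2 e*_1 = e*_2 e*_1 e*_2, each side carries
-- three such counters, and column by column the counters of the two sides stay related by
-- the tropical map (a, b, c) ↦ (b + (c ∸ a), a ⊓ c, b + (a ∸ c)).  Given these Coxeter
-- relations, both sides of the theorem are reduced words of the longest permutation, and
-- one is turned into the other by sliding  s_{i+1} (s_a ⋯ s_b) = (s_a ⋯ s_b) s_i  (a ≤ i < b).

module Submission where

open import Defs
open import Data.Bool using (Bool; true; false; if_then_else_; _∧_; _∨_; not; T)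
open import Data.Bool.ListAction using (any)
open import Data.Bool.Properties
  using (∨-assoc; ∨-identityʳ; ∨-zeroʳ; ∧-identityʳ; ∧-zeroʳ; if-float; if-eta)
open import Data.Empty using (⊥-elim)
open import Data.Fin using (Fin; toℕ)
import Data.Fin as Fin
open import Data.Fin.Properties using (toℕ-injective)
open import Data.List using (List; []; _∷_; _++_; [_]; foldr; drop; concatMap; map)
import Data.List as List
open import Data.List.Membership.Propositional using (_∈_)
open import Data.List.Membership.Propositional.Properties using (∈-allFin)
open import Data.List.Properties
  using (++-assoc; ++-identityʳ; drop-[]; foldr-++; foldr-cong; map-cong; map-cong-local; ∷-injective)
open import Data.List.Relation.Unary.All using (All; []; _∷_)
import Data.List.Relation.Unary.All as All
open import Data.List.Relation.Unary.Unique.Propositional using (Unique; []; _∷_)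
open import Data.List.Relation.Unary.Unique.Propositional.Properties using (allFin⁺)
open import Data.Nat using (ℕ; zero; suc; pred; _+_; _∸_; _≡ᵇ_; _<_; _≤_; _≥_; s≤s; z≤n)
open import Data.Nat.Properties
  using ( +-suc; +-identityʳ; +-comm; +-monoʳ-<; m+n∸m≡n; ≡ᵇ⇒≡; ≤-refl; ≤-reflexive; ≤-trans; ≤-pred
        ; <-trans; <-≤-trans; <-irrefl; <⇒≤; <⇒≢; >⇒≢; <⇒≱; n<1+n; m<n⇒m<1+n; m≤n⇒m≤1+n
        ; m≤n⇒m<n∨m≡n; m≤m+n; m<m+n )
open import Data.Product using (_×_; _,_; proj₁; proj₂)
open import Data.Sum using (_⊎_; inj₁; inj₂)
import Data.Sum as Sum
open import Data.Unit using (tt)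
open import Data.Vec using (Vec; []; _∷_; head; tail; lookup; tabulate)
import Data.Vec as Vec
open import Data.Vec.Properties using (lookup∘tabulate; tabulate∘lookup; tabulate-cong; tabulate-∘; lookup-map)
open import Function using (id)
open import Relation.Binary.PropositionalEquality
  using (_≡_; _≢_; refl; cong; cong₂; sym; trans; subst; module ≡-Reasoning)
open import Relation.Nullary using (contradiction)

-- Entry k of a column is its ball in row k + 1, so e★ k is the paper's e*_{k+1}.
Column : ℕ → Set
Column = Vec Bool

entry : ∀ {L} → ℕ → Column L → Bool
entry _       []      = false
entry zero    (b ∷ _) = b
entry (suc k) (_ ∷ x) = entry k x

-- Used only when entry (suc k) holds a ball, which it thus moves down one row.
lower : ∀ {L} → ℕ → Column L → Column L
lower zero    (_ ∷ _ ∷ x) = true ∷ false ∷ x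
lower (suc k) (b ∷ x)     = b ∷ lower k x
lower _       x           = x

withCloser : Bool → ℕ → ℕ
withCloser b c = if b then suc c else c

withOpener : Bool → ℕ → ℕ
withOpener b c = if b then pred c else c

unmatched : ∀ {L} → ℕ → ℕ → Column L → Bool
unmatched k c x = entry (suc k) x ∧ (withCloser (entry k x) c ≡ᵇ 0)

lowerIfUnmatched : ∀ {L} → ℕ → ℕ → Column L → Column L
lowerIfUnmatched k c x = if unmatched k c x then lower k x else x

freeClosersPast : ∀ {L} → ℕ → Column L → ℕ → ℕ
freeClosersPast k x c = withOpener (entry (suc k) x) (withCloser (entry k x) c)

freeClosers : ∀ {L} → ℕ → List (Column L) → ℕ
freeClosers k []       = 0
freeClosers k (x ∷ xs) = freeClosersPast k x (freeClosers k xs)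

e★ : ∀ {L} → ℕ → List (Column L) → List (Column L)
e★ k []       = []
e★ k (x ∷ xs) = lowerIfUnmatched k (freeClosers k xs) x ∷ e★ k xs

entry-lower : ∀ {L i} k (x : Column L) → i < k ⊎ suc k < i → entry i (lower k x) ≡ entry i x
entry-lower                   zero    []          _                    = refl
entry-lower                   zero    (_ ∷ [])    _                    = refl
entry-lower {i = suc (suc _)} zero    (_ ∷ _ ∷ _) (inj₂ (s≤s (s≤s _))) = refl
entry-lower                   (suc k) []          _                    = refl
entry-lower {i = zero}        (suc k) (_ ∷ _)     _                    = refl
entry-lower {i = suc i}       (suc k) (_ ∷ x)     apart                =
  entry-lower k x (Sum.map ≤-pred ≤-pred apart)

entry-lowerIf : ∀ {L i} b k (x : Column L) → i < k ⊎ suc k < i →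
  entry i (if b then lower k x else x) ≡ entry i x
entry-lowerIf true  k x apart = entry-lower k x apart
entry-lowerIf false k x apart = refl

Apart : ℕ → ℕ → Set
Apart i k = suc i < k ⊎ suc k < i

module _ {L i k : ℕ} (b : Bool) (x : Column L) (apart : Apart i k) where
  private
    x′ : Column L
    x′ = if b then lower k x else x

    entry-i : entry i x′ ≡ entry i x
    entry-i = entry-lowerIf b k x (Sum.map (<-trans (n<1+n i)) id apart)

    entry-suc-i : entry (suc i) x′ ≡ entry (suc i) x
    entry-suc-i = entry-lowerIf b k x (Sum.map id m<n⇒m<1+n apart)

  unmatched-lowerIf : ∀ c → unmatched i c x′ ≡ unmatched i c x
  unmatched-lowerIf c = cong₂ (λ p q → q ∧ (withCloser p c ≡ᵇ 0)) entry-i entry-suc-i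

  freeClosersPast-lowerIf : ∀ c → freeClosersPast i x′ c ≡ freeClosersPast i x c
  freeClosersPast-lowerIf c = cong₂ (λ p q → withOpener q (withCloser p c)) entry-i entry-suc-i

freeClosers-e★-apart : ∀ {L i k} (xs : List (Column L)) → Apart i k →
  freeClosers i (e★ k xs) ≡ freeClosers i xs
freeClosers-e★-apart             []       apart = refl
freeClosers-e★-apart {i = i} {k} (x ∷ xs) apart = trans
  (freeClosersPast-lowerIf (unmatched k (freeClosers k xs) x) x apart _)
  (cong (freeClosersPast i x) (freeClosers-e★-apart xs apart))

lower-comm : ∀ {L} a b (x : Column L) → suc a < b → lower a (lower b x) ≡ lower b (lower a x)
lower-comm zero    (suc zero)    _           (s≤s ())
lower-comm zero    (suc (suc b)) []          _        = refl
lower-comm zero    (suc (suc b)) (_ ∷ [])    _        = refl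
lower-comm zero    (suc (suc b)) (_ ∷ _ ∷ _) _        = refl
lower-comm (suc a) (suc b)       []          _        = refl
lower-comm (suc a) (suc b)       (p ∷ x)     (s≤s lt) = cong (p ∷_) (lower-comm a b x lt)

lowerIfUnmatched-comm : ∀ {L} a b c d (x : Column L) → suc a < b →
  lowerIfUnmatched a c (lowerIfUnmatched b d x) ≡ lowerIfUnmatched b d (lowerIfUnmatched a c x)
lowerIfUnmatched-comm a b c d x lt
  rewrite unmatched-lowerIf (unmatched b d x) x (inj₁ lt) c
        | unmatched-lowerIf (unmatched a c x) x (inj₂ lt) d
  with unmatched a c x | unmatched b d x
... | true  | true  = lower-comm a b x lt
... | true  | false = refl
... | false | _     = refl

e★-comm : ∀ {L} a b (xs : List (Column L)) → suc a < b → e★ a (e★ b xs) ≡ e★ b (e★ a xs)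
e★-comm a b []       lt = refl
e★-comm a b (x ∷ xs) lt = cong₂ _∷_
  (begin
    lowerIfUnmatched a (freeClosers a (e★ b xs)) xb  ≡⟨ cong (λ c → lowerIfUnmatched a c xb)
                                                             (freeClosers-e★-apart xs (inj₁ lt)) ⟩
    lowerIfUnmatched a (freeClosers a xs) xb         ≡⟨ lowerIfUnmatched-comm a b _ _ x lt ⟩
    lowerIfUnmatched b (freeClosers b xs) xa         ≡⟨ cong (λ c → lowerIfUnmatched b c xa)
                                                             (freeClosers-e★-apart xs (inj₂ lt)) ⟨
    lowerIfUnmatched b (freeClosers b (e★ a xs)) xa  ∎)
  (e★-comm a b xs lt)
  where
  open ≡-Reasoning
  xa xb : Column _
  xa = lowerIfUnmatched a (freeClosers a xs) x
  xb = lowerIfUnmatched b (freeClosers b xs) x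

pattern ● = true
pattern ○ = false

Counts : Set
Counts = ℕ × ℕ × ℕ

-- The graph of the tropical map (a, b, c) ↦ (b + (c ∸ a), a ⊓ c, b + (a ∸ c)), split by
-- comparing a with c.
data Braided : Counts → Counts → Set where
  ≥-case : ∀ m k b → Braided (k + m , b , m) (b , m , k + b)
  ≤-case : ∀ m k b → Braided (m , b , k + m) (k + b , m , b)

≥-case′ : ∀ m k b {s t} → s ≡ k + m → t ≡ k + b → Braided (s , b , m) (b , m , t)
≥-case′ m k b refl refl = ≥-case m k b

≤-case′ : ∀ m k b {s t} → s ≡ k + m → t ≡ k + b → Braided (m , b , s) (t , m , b)
≤-case′ m k b refl refl = ≤-case m k b

module _ {L : ℕ} where
  threeSteps : ℕ → ℕ → Counts → Column L → Column L × Counts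
  threeSteps i j (s₁ , s₂ , s₃) x =
    let x₁ = lowerIfUnmatched i s₁ x ; x₂ = lowerIfUnmatched j s₂ x₁
    in  lowerIfUnmatched i s₃ x₂
      , freeClosersPast i x s₁ , freeClosersPast j x₁ s₂ , freeClosersPast i x₂ s₃

  threeCounts : ℕ → ℕ → List (Column L) → Counts
  threeCounts i j xs = freeClosers i xs , freeClosers j (e★ i xs) , freeClosers i (e★ j (e★ i xs))

column-braid : ∀ {L} (x : Column (3 + L)) {s t} → Braided s t →
  let (y , s′) = threeSteps 0 1 s x ; (z , t′) = threeSteps 1 0 t x in y ≡ z × Braided s′ t′
column-braid (● ∷ ● ∷ ● ∷ _) (≥-case m k b)                   = refl , ≥-case m k b
column-braid (● ∷ ● ∷ ● ∷ _) (≤-case m k b)                   = refl , ≤-case m k b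
column-braid (● ∷ ● ∷ ○ ∷ _) (≥-case m k b)                   =
  refl , ≥-case′ m k (suc b) refl (sym (+-suc k b))
column-braid (● ∷ ● ∷ ○ ∷ _) (≤-case m k b)                   =
  refl , ≤-case′ m k (suc b) refl (sym (+-suc k b))
column-braid (● ∷ ○ ∷ ● ∷ _) (≥-case m 0 0)                   = refl , ≥-case m 1 0
column-braid (● ∷ ○ ∷ ● ∷ _) (≥-case m 0 (suc b))             = refl , ≥-case (suc m) 0 b
column-braid (● ∷ ○ ∷ ● ∷ _) (≥-case m (suc k) 0)             = refl , ≥-case m (suc (suc k)) 0
column-braid (● ∷ ○ ∷ ● ∷ _) (≥-case m (suc k) (suc b))       =
  refl , ≥-case′ (suc m) (suc k) b (cong suc (sym (+-suc k m))) (+-suc k b)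
column-braid (● ∷ ○ ∷ ● ∷ _) (≤-case m 0 0)                   = refl , ≥-case m 1 0
column-braid (● ∷ ○ ∷ ● ∷ _) (≤-case m 0 (suc b))             = refl , ≥-case (suc m) 0 b
column-braid (● ∷ ○ ∷ ● ∷ _) (≤-case m (suc k) 0)             =
  refl , ≤-case′ (suc m) k 0 (sym (+-suc k m)) refl
column-braid (● ∷ ○ ∷ ● ∷ _) (≤-case m (suc k) (suc b))       =
  refl , ≤-case′ (suc m) (suc k) b (cong suc (sym (+-suc k m))) (+-suc k b)
column-braid (● ∷ ○ ∷ ○ ∷ _) (≥-case m k b)                   =
  refl , ≥-case′ (suc m) k b (sym (+-suc k m)) refl
column-braid (● ∷ ○ ∷ ○ ∷ _) (≤-case m k b)                   =
  refl , ≤-case′ (suc m) k b (sym (+-suc k m)) refl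
column-braid (○ ∷ ● ∷ ● ∷ _) (≥-case 0 0 0)                   = refl , ≥-case 0 0 0
column-braid (○ ∷ ● ∷ ● ∷ _) (≥-case 0 0 (suc b))             = refl , ≤-case 0 1 b
column-braid (○ ∷ ● ∷ ● ∷ _) (≥-case (suc m) 0 0)             = refl , ≥-case m 0 0
column-braid (○ ∷ ● ∷ ● ∷ _) (≥-case (suc m) 0 (suc b))       = refl , ≥-case m 0 (suc b)
column-braid (○ ∷ ● ∷ ● ∷ _) (≥-case 0 (suc k) b)             = refl , ≥-case 0 k b
column-braid (○ ∷ ● ∷ ● ∷ _) (≥-case (suc m) (suc k) b)       = refl , ≥-case′ m (suc k) b (+-suc k m) refl
column-braid (○ ∷ ● ∷ ● ∷ _) (≤-case 0 0 0)                   = refl , ≥-case 0 0 0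
column-braid (○ ∷ ● ∷ ● ∷ _) (≤-case 0 0 (suc b))             = refl , ≤-case 0 1 b
column-braid (○ ∷ ● ∷ ● ∷ _) (≤-case (suc m) 0 0)             = refl , ≥-case m 0 0
column-braid (○ ∷ ● ∷ ● ∷ _) (≤-case (suc m) 0 (suc b))       = refl , ≥-case m 0 (suc b)
column-braid (○ ∷ ● ∷ ● ∷ _) (≤-case 0 (suc k) 0)             = refl , ≤-case 0 (suc k) 0
column-braid (○ ∷ ● ∷ ● ∷ _) (≤-case 0 (suc k) (suc b))       =
  refl , ≤-case′ 0 (suc (suc k)) b refl (cong suc (+-suc k b))
column-braid (○ ∷ ● ∷ ● ∷ _) (≤-case (suc m) (suc k) 0)       = refl , ≤-case′ m (suc k) 0 (+-suc k m) refl
column-braid (○ ∷ ● ∷ ● ∷ _) (≤-case (suc m) (suc k) (suc b)) =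
  refl , ≤-case′ m (suc k) (suc b) (+-suc k m) refl
column-braid (○ ∷ ● ∷ ○ ∷ _) (≥-case 0 0 b)                   = refl , ≤-case 0 1 b
column-braid (○ ∷ ● ∷ ○ ∷ _) (≥-case (suc m) 0 b)             = refl , ≥-case m 0 (suc b)
column-braid (○ ∷ ● ∷ ○ ∷ _) (≥-case 0 (suc k) b)             =
  refl , ≥-case′ 0 k (suc b) refl (sym (+-suc k b))
column-braid (○ ∷ ● ∷ ○ ∷ _) (≥-case (suc m) (suc k) b)       =
  refl , ≥-case′ m (suc k) (suc b) (+-suc k m) (cong suc (sym (+-suc k b)))
column-braid (○ ∷ ● ∷ ○ ∷ _) (≤-case 0 0 b)                   = refl , ≤-case 0 1 b
column-braid (○ ∷ ● ∷ ○ ∷ _) (≤-case (suc m) 0 b)             = refl , ≥-case m 0 (suc b)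
column-braid (○ ∷ ● ∷ ○ ∷ _) (≤-case 0 (suc k) b)             = refl , ≤-case 0 (suc (suc k)) b
column-braid (○ ∷ ● ∷ ○ ∷ _) (≤-case (suc m) (suc k) b)       =
  refl , ≤-case′ m (suc k) (suc b) (+-suc k m) (cong suc (sym (+-suc k b)))
column-braid (○ ∷ ○ ∷ ● ∷ _) (≥-case 0 0 0)                   = refl , ≥-case 0 0 0
column-braid (○ ∷ ○ ∷ ● ∷ _) (≥-case 0 0 (suc b))             = refl , ≥-case 0 0 b
column-braid (○ ∷ ○ ∷ ● ∷ _) (≥-case (suc m) 0 0)             = refl , ≥-case m 1 0
column-braid (○ ∷ ○ ∷ ● ∷ _) (≥-case (suc m) 0 (suc b))       = refl , ≥-case (suc m) 0 b
column-braid (○ ∷ ○ ∷ ● ∷ _) (≥-case 0 (suc k) 0)             = refl , ≥-case 0 (suc k) 0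
column-braid (○ ∷ ○ ∷ ● ∷ _) (≥-case 0 (suc k) (suc b))       = refl , ≥-case′ 0 (suc k) b refl (+-suc k b)
column-braid (○ ∷ ○ ∷ ● ∷ _) (≥-case (suc m) (suc k) 0)       =
  refl , ≥-case′ m (suc (suc k)) 0 (cong suc (+-suc k m)) refl
column-braid (○ ∷ ○ ∷ ● ∷ _) (≥-case (suc m) (suc k) (suc b)) =
  refl , ≥-case′ (suc m) (suc k) b refl (+-suc k b)
column-braid (○ ∷ ○ ∷ ● ∷ _) (≤-case 0 0 0)                   = refl , ≥-case 0 0 0
column-braid (○ ∷ ○ ∷ ● ∷ _) (≤-case 0 0 (suc b))             = refl , ≥-case 0 0 b
column-braid (○ ∷ ○ ∷ ● ∷ _) (≤-case (suc m) 0 0)             = refl , ≥-case m 1 0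
column-braid (○ ∷ ○ ∷ ● ∷ _) (≤-case (suc m) 0 (suc b))       = refl , ≥-case (suc m) 0 b
column-braid (○ ∷ ○ ∷ ● ∷ _) (≤-case m (suc k) 0)             = refl , ≤-case m k 0
column-braid (○ ∷ ○ ∷ ● ∷ _) (≤-case m (suc k) (suc b))       = refl , ≤-case′ m (suc k) b refl (+-suc k b)
column-braid (○ ∷ ○ ∷ ○ ∷ _) (≥-case m k b)                   = refl , ≥-case m k b
column-braid (○ ∷ ○ ∷ ○ ∷ _) (≤-case m k b)                   = refl , ≤-case m k b

e★-braid₀ : ∀ {L} (xs : List (Column (3 + L))) →
  Braided (threeCounts 0 1 xs) (threeCounts 1 0 xs) × e★ 0 (e★ 1 (e★ 0 xs)) ≡ e★ 1 (e★ 0 (e★ 1 xs))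
e★-braid₀ []       = ≥-case 0 0 0 , refl
e★-braid₀ (x ∷ xs) with e★-braid₀ xs
... | braided , eq with column-braid x braided
...   | column-eq , braided′ = braided′ , cong₂ _∷_ column-eq eq

freeClosers-suc : ∀ {L} k (xs : List (Column (suc L))) → freeClosers (suc k) xs ≡ freeClosers k (map tail xs)
freeClosers-suc k []             = refl
freeClosers-suc k ((_ ∷ x) ∷ xs) = cong (freeClosersPast k x) (freeClosers-suc k xs)

map-head-e★-suc : ∀ {L} k (xs : List (Column (suc L))) → map head (e★ (suc k) xs) ≡ map head xs
map-head-e★-suc k []             = refl
map-head-e★-suc k ((h ∷ x) ∷ xs) =
  cong₂ _∷_ (trans (if-float head (unmatched k _ x)) (if-eta (unmatched k _ x))) (map-head-e★-suc k xs)

map-tail-e★-suc : ∀ {L} k (xs : List (Column (suc L))) → map tail (e★ (suc k) xs) ≡ e★ k (map tail xs)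
map-tail-e★-suc k []             = refl
map-tail-e★-suc k ((h ∷ x) ∷ xs) = cong₂ _∷_
  (trans (if-float tail (unmatched k _ x)) (cong (λ c → lowerIfUnmatched k c x) (freeClosers-suc k xs)))
  (map-tail-e★-suc k xs)

map-head-tail-injective : ∀ {L} {xs ys : List (Column (suc L))} →
  map head xs ≡ map head ys → map tail xs ≡ map tail ys → xs ≡ ys
map-head-tail-injective {xs = []}           {[]}            _  _  = refl
map-head-tail-injective {xs = (h ∷ x) ∷ xs} {(h′ ∷ y) ∷ ys} hs ts
  with refl , hs′ ← ∷-injective hs | refl , ts′ ← ∷-injective ts =
  cong (_ ∷_) (map-head-tail-injective hs′ ts′)

e★-braid : ∀ {L} k (xs : List (Column L)) → 2 + k < L →
  e★ k (e★ (suc k) (e★ k xs)) ≡ e★ (suc k) (e★ k (e★ (suc k) xs))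
e★-braid zero xs (s≤s (s≤s (s≤s _))) = proj₂ (e★-braid₀ xs)
e★-braid {suc L} (suc k) xs (s≤s 2+k<L) = map-head-tail-injective
  (trans (heads k (suc k) xs) (sym (heads (suc k) k xs)))
  (begin
    map tail (e★ (suc k) (e★ (2 + k) (e★ (suc k) xs)))  ≡⟨ tails k (suc k) xs ⟩
    e★ k (e★ (suc k) (e★ k (map tail xs)))              ≡⟨ e★-braid k (map tail xs) 2+k<L ⟩
    e★ (suc k) (e★ k (e★ (suc k) (map tail xs)))        ≡⟨ tails (suc k) k xs ⟨
    map tail (e★ (2 + k) (e★ (suc k) (e★ (2 + k) xs)))  ∎)
  where
  open ≡-Reasoning
  heads : ∀ i j (xs : List (Column (suc L))) →
    map head (e★ (suc i) (e★ (suc j) (e★ (suc i) xs))) ≡ map head xs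
  heads i j xs = trans (map-head-e★-suc i _) (trans (map-head-e★-suc j _) (map-head-e★-suc i xs))
  tails : ∀ i j (xs : List (Column (suc L))) →
    map tail (e★ (suc i) (e★ (suc j) (e★ (suc i) xs))) ≡ e★ i (e★ j (e★ i (map tail xs)))
  tails i j xs = trans (map-tail-e★-suc i _)
    (cong (e★ i) (trans (map-tail-e★-suc j _) (cong (e★ j) (map-tail-e★-suc i xs))))

-- e a plays the simple transposition s_a.
module Staircase {T : Set} (N : ℕ) (e : ℕ → T → T)
  (e-comm  : ∀ {a b} x → suc a < b → b < N → e a (e b x) ≡ e b (e a x))
  (e-braid : ∀ {a} x → suc a < N → e a (e (suc a) (e a x)) ≡ e (suc a) (e a (e (suc a) x)))
  where
  open ≡-Reasoning

  segment : ℕ → ℕ → T → T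
  segment a zero    x = x
  segment a (suc m) x = segment a m (e (a + m) x)

  segment-suc : ∀ a m x → segment a (suc m) x ≡ e a (segment (suc a) m x)
  segment-suc a zero    x = cong (λ i → e i x) (+-identityʳ a)
  segment-suc a (suc m) x = begin
    segment a (suc m) (e (a + suc m) x)        ≡⟨ segment-suc a m _ ⟩
    e a (segment (suc a) m (e (a + suc m) x))  ≡⟨ cong (λ i → e a (segment (suc a) m (e i x))) (+-suc a m) ⟩
    e a (segment (suc a) (suc m) x)            ∎

  segment-suc₂ : ∀ a m x → segment a (2 + m) x ≡ e a (e (suc a) (segment (2 + a) m x))
  segment-suc₂ a m x = trans (segment-suc a (suc m) x) (cong (e a) (segment-suc (suc a) m x))

  e-comm-segment : ∀ {i b} m x → suc i < b → b + m ≤ N → e i (segment b m x) ≡ segment b m (e i x)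
  e-comm-segment         zero    x _   _     = refl
  e-comm-segment {i} {b} (suc m) x i<b b+m≤N = begin
    e i (segment b (suc m) x)        ≡⟨ cong (e i) (segment-suc b m x) ⟩
    e i (e b (segment (suc b) m x))  ≡⟨ e-comm _ i<b (<-≤-trans (m<m+n b (s≤s z≤n)) b+m≤N) ⟩
    e b (e i (segment (suc b) m x))  ≡⟨ cong (e b) (e-comm-segment m x (m<n⇒m<1+n i<b)
                                                       (subst (_≤ N) (+-suc b m) b+m≤N)) ⟩
    e b (segment (suc b) m (e i x))  ≡⟨ segment-suc b m (e i x) ⟨
    segment b (suc m) (e i x)        ∎

  e-suc-segment : ∀ {a i} m x → a ≤ i → suc i < a + m → a + m ≤ N →
    e (suc i) (segment a m x) ≡ segment a m (e i x)
  e-suc-segment {a} {i} zero x a≤i i<a+0 _ =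
    ⊥-elim (<⇒≱ i<a+0 (≤-trans (≤-reflexive (+-identityʳ a)) (m≤n⇒m≤1+n a≤i)))
  e-suc-segment {a} {i} (suc m) x a≤i i<a+m a+m≤N with m≤n⇒m<n∨m≡n a≤i
  ... | inj₁ a<i = begin
    e (suc i) (segment a (suc m) x)        ≡⟨ cong (e (suc i)) (segment-suc a m x) ⟩
    e (suc i) (e a (segment (suc a) m x))  ≡⟨ e-comm _ (s≤s a<i) (<-≤-trans i<a+m a+m≤N) ⟨
    e a (e (suc i) (segment (suc a) m x))  ≡⟨ cong (e a) (e-suc-segment m x a<i
                                                (subst (suc i <_) (+-suc a m) i<a+m)
                                                (subst (_≤ N) (+-suc a m) a+m≤N)) ⟩
    e a (segment (suc a) m (e i x))        ≡⟨ segment-suc a m (e i x) ⟨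
    segment a (suc m) (e i x)              ∎
  ... | inj₂ refl with m
  ...   | zero  = ⊥-elim (<-irrefl (sym (+-comm a 1)) i<a+m)
  ...   | suc m = begin
    e (suc a) (segment a (2 + m) x)                    ≡⟨ cong (e (suc a)) (segment-suc₂ a m x) ⟩
    e (suc a) (e a (e (suc a) (segment (2 + a) m x)))  ≡⟨ e-braid _ (<-≤-trans i<a+m a+m≤N) ⟨
    e a (e (suc a) (e a (segment (2 + a) m x)))        ≡⟨ cong (λ y → e a (e (suc a) y))
                                                            (e-comm-segment m x ≤-refl 2+a+m≤N) ⟩
    e a (e (suc a) (segment (2 + a) m (e a x)))        ≡⟨ segment-suc₂ a m (e a x) ⟨
    segment a (2 + m) (e a x)                          ∎
    where
    2+a+m≤N : 2 + a + m ≤ N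
    2+a+m≤N = subst (_≤ N) (trans (+-suc a (suc m)) (cong suc (+-suc a m))) a+m≤N

  segment-shift : ∀ {a m} k x → k < m → a + m ≤ N →
    segment (suc a) k (segment a m x) ≡ segment a m (segment a k x)
  segment-shift         zero    x _   _     = refl
  segment-shift {a} {m} (suc k) x k<m a+m≤N = begin
    segment (suc a) k (e (suc (a + k)) (segment a m x))  ≡⟨ cong (segment (suc a) k)
                                                              (e-suc-segment m x (m≤m+n a k) a+k<a+m a+m≤N) ⟩
    segment (suc a) k (segment a m (e (a + k) x))        ≡⟨ segment-shift k (e (a + k) x) (<⇒≤ k<m) a+m≤N ⟩
    segment a m (segment a (suc k) x)                    ∎
    where
    a+k<a+m : suc (a + k) < a + m
    a+k<a+m = subst (_< a + m) (+-suc a k) (+-monoʳ-< a k<m)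

  growing : ℕ → ℕ → T → T
  growing a zero    x = x
  growing a (suc m) x = segment a (suc m) (growing a m x)

  shrinking : ℕ → ℕ → T → T
  shrinking a zero    x = x
  shrinking a (suc m) x = shrinking (suc a) m (segment a (N ∸ a) x)

  growing-segment : ∀ {a m} j x → j ≤ m → a + suc m ≤ N →
    growing (suc a) j (segment a (suc m) x) ≡ segment a (suc m) (growing a j x)
  growing-segment zero    x _   _     = refl
  growing-segment (suc j) x j<m a+m≤N = trans
    (cong (segment _ (suc j)) (growing-segment j x (<⇒≤ j<m) a+m≤N))
    (segment-shift (suc j) _ (s≤s j<m) a+m≤N)

  shrinking≡growing : ∀ a m x → a + m ≡ N → shrinking a m x ≡ growing a m x
  shrinking≡growing a zero    x _     = refl
  shrinking≡growing a (suc m) x a+m≡N = begin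
    shrinking (suc a) m (segment a (N ∸ a) x)  ≡⟨ cong (λ l → shrinking (suc a) m (segment a l x)) N∸a≡1+m ⟩
    shrinking (suc a) m (segment a (suc m) x)  ≡⟨ shrinking≡growing (suc a) m _ (trans (sym (+-suc a m)) a+m≡N) ⟩
    growing (suc a) m (segment a (suc m) x)    ≡⟨ growing-segment m x ≤-refl (≤-reflexive a+m≡N) ⟩
    segment a (suc m) (growing a m x)          ∎
    where
    N∸a≡1+m : N ∸ a ≡ suc m
    N∸a≡1+m = trans (cong (_∸ a) (sym a+m≡N)) (m+n∸m≡n a (suc m))

≡ᵇ-refl : ∀ n → (n ≡ᵇ n) ≡ true
≡ᵇ-refl zero    = refl
≡ᵇ-refl (suc n) = ≡ᵇ-refl n

≢⇒≡ᵇ≡false : ∀ {m n} → m ≢ n → (m ≡ᵇ n) ≡ false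
≢⇒≡ᵇ≡false {m} {n} m≢n with m ≡ᵇ n in eq
... | false = refl
... | true  = contradiction (≡ᵇ⇒≡ m n (subst T (sym eq) tt)) m≢n

-- The stack procedure of unmatchedOpen, run from the right: the closers still waiting for an
-- opener, and the columns of the openers found unmatched.
Scan : ℕ → Set
Scan n = ℕ × List (Fin n)

openAt : ∀ {n} → Fin n → Scan n → Scan n
openAt j (c , U) = pred c , (if c ≡ᵇ 0 then U ++ [ j ] else U)

closeAt : ∀ {n} → Scan n → Scan n
closeAt (c , U) = suc c , U

scanLetter : ∀ {n} → ℕ → ℕ × Fin n → Scan n → Scan n
scanLetter i (r , j) σ = if r ≡ᵇ suc i then openAt j σ else if r ≡ᵇ i then closeAt σ else σ

scan : ∀ {n} → ℕ → List (ℕ × Fin n) → Scan n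
scan i = foldr (scanLetter i) (0 , [])

unmatchedOpen-scan : ∀ {n} i (w : List (ℕ × Fin n)) s →
  unmatchedOpen i w s ≡ proj₂ (scan i w) ++ drop (proj₁ (scan i w)) s
unmatchedOpen-scan i [] s = refl
unmatchedOpen-scan i ((r , j) ∷ w) s with r ≡ᵇ suc i | r ≡ᵇ i | scan i w | unmatchedOpen-scan i w
... | true  | _     | zero  , U | ih = trans (ih (j ∷ s)) (sym (++-assoc U [ j ] s))
... | true  | _     | suc c , U | ih = ih (j ∷ s)
unmatchedOpen-scan i ((r , j) ∷ w) []      | false | true | c , U | ih =
  trans (ih []) (cong (U ++_) (drop-[] c))
unmatchedOpen-scan i ((r , j) ∷ w) (_ ∷ s) | false | true | c , U | ih = ih s
... | false | false | c , U | ih = ih s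

scanEntries : ∀ {n} → Bool → Bool → Fin n → Scan n → Scan n
scanEntries p q j (c , U) =
  withOpener q (withCloser p c) , (if q ∧ (withCloser p c ≡ᵇ 0) then U ++ [ j ] else U)

scanColumn : ∀ {L n} → ℕ → Column L → Fin n → Scan n → Scan n
scanColumn k x = scanEntries (entry k x) (entry (suc k) x)

scanColumns : ∀ {L n} → ℕ → (Fin n → Column L) → List (Fin n) → Scan n
scanColumns k column = foldr (λ j → scanColumn k (column j) j) (0 , [])

module _ {A : Set} (f : ℕ → A → A) (k : ℕ)
         (inert : ∀ {r} → r ≢ suc k → r ≢ suc (suc k) → ∀ σ → f r σ ≡ σ) where

  foldr-rowsDown-inert : ∀ m σ → m ≤ k → foldr f σ (rowsDown m) ≡ σ
  foldr-rowsDown-inert zero    σ _   = refl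
  foldr-rowsDown-inert (suc m) σ m<k = trans
    (inert (<⇒≢ (s≤s m<k)) (<⇒≢ (m<n⇒m<1+n (s≤s m<k))) _)
    (foldr-rowsDown-inert m σ (<⇒≤ m<k))

  foldr-rowsDown : ∀ m σ → suc (suc k) ≤ m → foldr f σ (rowsDown m) ≡ f (suc (suc k)) (f (suc k) σ)
  foldr-rowsDown (suc m) σ (s≤s k<m) with m≤n⇒m<n∨m≡n k<m
  ... | inj₂ refl  = cong (λ σ′ → f (suc (suc k)) (f (suc k) σ′)) (foldr-rowsDown-inert k σ ≤-refl)
  ... | inj₁ 1+k<m = trans
    (cong (f (suc m)) (foldr-rowsDown m σ 1+k<m))
    (inert (>⇒≢ (s≤s (<⇒≤ 1+k<m))) (>⇒≢ (s≤s 1+k<m)) _)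

foldr-concatMap : ∀ {A B C : Set} (f : B → C → C) (g : A → List B) z xs →
  foldr f z (concatMap g xs) ≡ foldr (λ x z′ → foldr f z′ (g x)) z xs
foldr-concatMap f g z []       = refl
foldr-concatMap f g z (x ∷ xs) =
  trans (foldr-++ f z (g x) (concatMap g xs)) (cong (λ z′ → foldr f z′ (g x)) (foldr-concatMap f g z xs))

col : ∀ {L n} → M L n → Fin n → Column L
col B j = Vec.map (λ R → lookup R j) B

entry-col : ∀ {L n} (B : M L n) k j → entry k (col B j) ≡ ball B (suc k) j
entry-col []      k       j = refl
entry-col (R ∷ B) zero    j = refl
entry-col (R ∷ B) (suc k) j = entry-col B k j

module _ {n} (k : ℕ) (j : Fin n) where
  scanBall : ℕ → Bool → Scan n → Scan n
  scanBall r b σ = foldr (scanLetter (suc k)) σ (if b then (r , j) ∷ [] else [])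

  scanBall-inert : ∀ {r} b σ → r ≢ suc k → r ≢ suc (suc k) → scanBall r b σ ≡ σ
  scanBall-inert false σ _   _    = refl
  scanBall-inert true  σ r≢i r≢i′ rewrite ≢⇒≡ᵇ≡false r≢i′ | ≢⇒≡ᵇ≡false r≢i = refl

  scanLetter-close : ∀ σ → scanLetter (suc k) (suc k , j) σ ≡ closeAt σ
  scanLetter-close σ rewrite ≢⇒≡ᵇ≡false {k} {suc k} (<⇒≢ ≤-refl) | ≡ᵇ-refl k = refl

  scanLetter-open : ∀ σ → scanLetter (suc k) (suc (suc k) , j) σ ≡ openAt j σ
  scanLetter-open σ rewrite ≡ᵇ-refl k = refl

  scanBall-active : ∀ p q σ → scanBall (suc (suc k)) q (scanBall (suc k) p σ) ≡ scanEntries p q j σ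
  scanBall-active false false σ = refl
  scanBall-active false true  σ = scanLetter-open σ
  scanBall-active true  false σ = scanLetter-close σ
  scanBall-active true  true  σ = trans (scanLetter-open _) (cong (openAt j) (scanLetter-close σ))

scan-columnWord : ∀ {L n} k (B : M L n) → suc (suc k) ≤ L →
  scan (suc k) (cwTagged B) ≡ scanColumns k (col B) (allFinL n)
scan-columnWord {L} {n} k B 2+k≤L = trans
  (foldr-concatMap (scanLetter (suc k)) letters (0 , []) (allFinL n))
  (foldr-cong one-column refl (allFinL n))
  where
  open ≡-Reasoning
  letters : Fin n → List (ℕ × Fin n)
  letters j = concatMap (λ r → if ball B r j then (r , j) ∷ [] else []) (rowsDown L)
  one-column : ∀ j σ → foldr (scanLetter (suc k)) σ (letters j) ≡ scanColumn k (col B j) j σ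
  one-column j σ = begin
    foldr (scanLetter (suc k)) σ (letters j)
      ≡⟨ foldr-concatMap (scanLetter (suc k)) _ σ (rowsDown L) ⟩
    foldr (λ r → scanBall k j r (ball B r j)) σ (rowsDown L)
      ≡⟨ foldr-rowsDown (λ r → scanBall k j r (ball B r j)) k
           (λ {r} r≢i r≢i′ σ → scanBall-inert k j (ball B r j) σ r≢i r≢i′) L σ 2+k≤L ⟩
    scanBall k j (suc (suc k)) (ball B (suc (suc k)) j) (scanBall k j (suc k) (ball B (suc k) j) σ)
      ≡⟨ scanBall-active k j (ball B (suc k) j) (ball B (suc (suc k)) j) σ ⟩
    scanEntries (ball B (suc k) j) (ball B (suc (suc k)) j) j σ
      ≡⟨ cong₂ (λ p q → scanEntries p q j σ) (entry-col B k j) (entry-col B (suc k) j) ⟨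
    scanColumn k (col B j) j σ ∎

unmatchedAbove-scanColumns : ∀ {L n} k (B : M L n) j → suc (suc k) ≤ L →
  unmatchedAbove (suc k) B j ≡ any (finEq j) (proj₂ (scanColumns k (col B) (allFinL n)))
unmatchedAbove-scanColumns {n = n} k B j 2+k≤L = cong (any (finEq j)) (begin
  unmatchedOpen (suc k) (cwTagged B) []
    ≡⟨ unmatchedOpen-scan (suc k) (cwTagged B) [] ⟩
  proj₂ (scan (suc k) (cwTagged B)) ++ drop (proj₁ (scan (suc k) (cwTagged B))) []
    ≡⟨ cong (λ σ → proj₂ σ ++ drop (proj₁ σ) []) (scan-columnWord k B 2+k≤L) ⟩
  proj₂ σ ++ drop (proj₁ σ) []
    ≡⟨ cong (proj₂ σ ++_) (drop-[] (proj₁ σ)) ⟩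
  proj₂ σ ++ []
    ≡⟨ ++-identityʳ (proj₂ σ) ⟩
  proj₂ σ ∎)
  where
  open ≡-Reasoning
  σ : Scan n
  σ = scanColumns k (col B) (allFinL n)

any-++ : ∀ {A : Set} (p : A → Bool) xs ys → any p (xs ++ ys) ≡ any p xs ∨ any p ys
any-++ p []       ys = refl
any-++ p (x ∷ xs) ys = trans (cong (p x ∨_) (any-++ p xs ys)) (sym (∨-assoc (p x) _ _))

module _ {n} {j : Fin n} (U : List (Fin n)) where
  private
    any-snoc : ∀ j′ → any (finEq j′) (U ++ [ j ]) ≡ any (finEq j′) U ∨ finEq j′ j
    any-snoc j′ = trans (any-++ (finEq j′) U [ j ]) (cong (any (finEq j′) U ∨_) (∨-identityʳ (finEq j′ j)))

  any-snocIf-self : any (finEq j) U ≡ false → ∀ b → any (finEq j) (if b then U ++ [ j ] else U) ≡ b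
  any-snocIf-self j∉U false = j∉U
  any-snocIf-self j∉U true  = trans (any-snoc j) (cong₂ _∨_ j∉U (≡ᵇ-refl (toℕ j)))

  any-snocIf-other : ∀ j′ → j′ ≢ j → ∀ b →
    any (finEq j′) (if b then U ++ [ j ] else U) ≡ any (finEq j′) U
  any-snocIf-other j′ j′≢j false = refl
  any-snocIf-other j′ j′≢j true  = trans (any-snoc j′)
    (trans (cong (any (finEq j′) U ∨_) (≢⇒≡ᵇ≡false (λ eq → j′≢j (toℕ-injective eq)))) (∨-identityʳ _))

module _ {L n} (k : ℕ) (column : Fin n → Column L) where
  private
    lowerIf : Bool → Fin n → Column L
    lowerIf b j = if b then lower k (column j) else column j

  freeClosers-scanColumns : ∀ js → proj₁ (scanColumns k column js) ≡ freeClosers k (map column js)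
  freeClosers-scanColumns []       = refl
  freeClosers-scanColumns (j ∷ js) = cong (freeClosersPast k (column j)) (freeClosers-scanColumns js)

  scanColumns-fresh : ∀ {j js} → All (j ≢_) js → any (finEq j) (proj₂ (scanColumns k column js)) ≡ false
  scanColumns-fresh {js = []}    []            = refl
  scanColumns-fresh {j} {j′ ∷ _} (j≢j′ ∷ j∉js) =
    trans (any-snocIf-other _ j j≢j′ (unmatched k _ (column j′))) (scanColumns-fresh j∉js)

  e★-scanColumns : ∀ {js} → Unique js →
    e★ k (map column js) ≡ map (λ j → lowerIf (any (finEq j) (proj₂ (scanColumns k column js))) j) js
  e★-scanColumns {[]}     _             = refl
  e★-scanColumns {j ∷ js} (j∉js ∷ uniq) = cong₂ _∷_
    (cong (λ b → lowerIf b j) (sym (begin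
      any (finEq j) (proj₂ (scanColumn k (column j) j σ))
        ≡⟨ any-snocIf-self (proj₂ σ) (scanColumns-fresh j∉js) _ ⟩
      unmatched k (proj₁ σ) (column j)
        ≡⟨ cong (λ c → unmatched k c (column j)) (freeClosers-scanColumns js) ⟩
      unmatched k (freeClosers k (map column js)) (column j) ∎)))
    (trans (e★-scanColumns uniq) (map-cong-local (All.map
      (λ {j′} j≢j′ → cong (λ b → lowerIf b j′)
        (sym (any-snocIf-other (proj₂ σ) j′ (λ eq → j≢j′ (sym eq)) (unmatched k (proj₁ σ) (column j)))))
      j∉js)))
    where
    open ≡-Reasoning
    σ : Scan n
    σ = scanColumns k column js

lookup-lower : ∀ {L} k (x : Column L) r → suc k < L →
  lookup (lower k x) r ≡ (if toℕ r ≡ᵇ k then true else if toℕ r ≡ᵇ suc k then false else lookup x r)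
lookup-lower zero    (_ ∷ [])    _                     (s≤s ())
lookup-lower zero    (_ ∷ _ ∷ _) Fin.zero              _        = refl
lookup-lower zero    (_ ∷ _ ∷ _) (Fin.suc Fin.zero)    _        = refl
lookup-lower zero    (_ ∷ _ ∷ _) (Fin.suc (Fin.suc r)) _        = refl
lookup-lower (suc k) (_ ∷ _)     Fin.zero              _        = refl
lookup-lower (suc k) (_ ∷ x)     (Fin.suc r)           (s≤s lt) = lookup-lower k x r lt

rowUpdate : Bool → Bool → Bool → Bool → Bool
rowUpdate p q b u = if p then b ∨ u else if q then b ∧ not u else b

lookup-lowerIf : ∀ {L} k u (x : Column L) r → suc k < L →
  lookup (if u then lower k x else x) r ≡ rowUpdate (toℕ r ≡ᵇ k) (toℕ r ≡ᵇ suc k) (lookup x r) u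
lookup-lowerIf k true  x r lt =
  trans (lookup-lower k x r lt) (moved (toℕ r ≡ᵇ k) (toℕ r ≡ᵇ suc k) (lookup x r))
  where
  moved : ∀ p q b → (if p then true else if q then false else b) ≡ rowUpdate p q b true
  moved true  _     b = sym (∨-zeroʳ b)
  moved false true  b = sym (∧-zeroʳ b)
  moved false false b = refl
lookup-lowerIf k false x r lt = kept (toℕ r ≡ᵇ k) (toℕ r ≡ᵇ suc k) (lookup x r)
  where
  kept : ∀ p q b → b ≡ rowUpdate p q b false
  kept true  _     b = sym (∨-identityʳ b)
  kept false true  b = sym (∧-identityʳ b)
  kept false false b = refl

lookup-col : ∀ {L n} (B : M L n) j r → lookup (col B j) r ≡ ball B (suc (toℕ r)) j
lookup-col (R ∷ B) j Fin.zero    = refl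
lookup-col (R ∷ B) j (Fin.suc r) = lookup-col B j r

col-estar : ∀ {L n} k (B : M L n) j → suc k < L →
  col (estar (suc k) B) j ≡ (if unmatchedAbove (suc k) B j then lower k (col B j) else col B j)
col-estar k B j lt = begin
  col (estar (suc k) B) j                 ≡⟨ tabulate-∘ (λ R → lookup R j) _ ⟨
  tabulate (λ r → lookup (tabulate _) j)  ≡⟨ tabulate-cong (λ r → trans (lookup∘tabulate _ j) (row r)) ⟩
  tabulate (lookup x′)                    ≡⟨ tabulate∘lookup x′ ⟩
  x′                                      ∎
  where
  open ≡-Reasoning
  u : Bool
  u = unmatchedAbove (suc k) B j
  x′ : Column _
  x′ = if u then lower k (col B j) else col B j
  row : ∀ r → rowUpdate (toℕ r ≡ᵇ k) (toℕ r ≡ᵇ suc k) (ball B (suc (toℕ r)) j) u ≡ lookup x′ r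
  row r = trans (cong (λ b → rowUpdate (toℕ r ≡ᵇ k) (toℕ r ≡ᵇ suc k) b u) (sym (lookup-col B j r)))
                (sym (lookup-lowerIf k u (col B j) r lt))

toColumns : ∀ {L n} → M L n → List (Column L)
toColumns {n = n} B = map (col B) (allFinL n)

toList-tabulate : ∀ {A : Set} {n} (f : Fin n → A) → Vec.toList (tabulate f) ≡ List.tabulate f
toList-tabulate {n = zero}  f = refl
toList-tabulate {n = suc n} f = cong (f Fin.zero ∷_) (toList-tabulate (λ j → f (Fin.suc j)))

allFinL≡allFin : ∀ n → allFinL n ≡ List.allFin n
allFinL≡allFin n = toList-tabulate id

estar-toColumns : ∀ {L n} k (B : M L n) → suc k < L → toColumns (estar (suc k) B) ≡ e★ k (toColumns B)
estar-toColumns {n = n} k B lt = begin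
  map (col (estar (suc k) B)) (allFinL n)
    ≡⟨ map-cong (λ j → trans (col-estar k B j lt) (cong (λ u → lowerIf u j) (unmatchedAbove-scanColumns k B j lt)))
                (allFinL n) ⟩
  map (λ j → lowerIf (any (finEq j) (proj₂ (scanColumns k (col B) (allFinL n)))) j) (allFinL n)
    ≡⟨ e★-scanColumns k (col B) (subst Unique (sym (allFinL≡allFin n)) (allFin⁺ n)) ⟨
  e★ k (map (col B) (allFinL n)) ∎
  where
  open ≡-Reasoning
  lowerIf : Bool → Fin n → Column _
  lowerIf u j = if u then lower k (col B j) else col B j

map-≡⇒All : ∀ {A B : Set} {f g : A → B} xs → map f xs ≡ map g xs → All (λ x → f x ≡ g x) xs
map-≡⇒All []       _  = []
map-≡⇒All (x ∷ xs) eq with fx≡gx , eq′ ← ∷-injective eq = fx≡gx ∷ map-≡⇒All xs eq′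

toColumns-injective : ∀ {L n} {B B′ : M L n} → toColumns B ≡ toColumns B′ → B ≡ B′
toColumns-injective {n = n} {B} {B′} eq = begin
  B                                                      ≡⟨ rows-from-columns B ⟨
  tabulate (λ r → tabulate (λ j → lookup (col B j) r))   ≡⟨ tabulate-cong (λ r → tabulate-cong (λ j →
                                                              cong (λ x → lookup x r) (same-column j))) ⟩
  tabulate (λ r → tabulate (λ j → lookup (col B′ j) r))  ≡⟨ rows-from-columns B′ ⟩
  B′                                                     ∎
  where
  open ≡-Reasoning
  same-column : ∀ j → col B j ≡ col B′ j
  same-column j = All.lookup (map-≡⇒All (allFinL n) eq) (subst (j ∈_) (sym (allFinL≡allFin n)) (∈-allFin j))
  rows-from-columns : ∀ (C : M _ n) → tabulate (λ r → tabulate (λ j → lookup (col C j) r)) ≡ C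
  rows-from-columns C = trans
    (tabulate-cong (λ r → trans (tabulate-cong (λ j → lookup-map r (λ R → lookup R j) C))
                                (tabulate∘lookup (lookup C r))))
    (tabulate∘lookup C)

module _ {N n : ℕ} where
  private
    estars : List ℕ → M (suc N) n → M (suc N) n
    estars ks B = foldr (λ k → estar (suc k)) B ks

    e★s : List ℕ → List (Column (suc N)) → List (Column (suc N))
    e★s ks xs = foldr e★ xs ks

    toColumns-estars : ∀ {ks} (B : M (suc N) n) → All (_< N) ks →
      toColumns (estars ks B) ≡ e★s ks (toColumns B)
    toColumns-estars          B []           = refl
    toColumns-estars {k ∷ ks} B (k<N ∷ ks<N) =
      trans (estar-toColumns k (estars ks B) (s≤s k<N)) (cong (e★ k) (toColumns-estars B ks<N))

  estar-comm : ∀ {a b} (B : M (suc N) n) → suc a < b → b < N →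
    estar (suc a) (estar (suc b) B) ≡ estar (suc b) (estar (suc a) B)
  estar-comm {a} {b} B a<b b<N = toColumns-injective (trans (toColumns-estars B (a<N ∷ b<N ∷ []))
    (trans (e★-comm a b (toColumns B) a<b) (sym (toColumns-estars B (b<N ∷ a<N ∷ [])))))
    where
    a<N : a < N
    a<N = <-trans (<-trans (n<1+n a) a<b) b<N

  estar-braid : ∀ {a} (B : M (suc N) n) → suc a < N →
    estar (suc a) (estar (2 + a) (estar (suc a) B)) ≡ estar (2 + a) (estar (suc a) (estar (2 + a) B))
  estar-braid {a} B 1+a<N = toColumns-injective (trans (toColumns-estars B (a<N ∷ 1+a<N ∷ a<N ∷ []))
    (trans (e★-braid a (toColumns B) (s≤s 1+a<N)) (sym (toColumns-estars B (1+a<N ∷ a<N ∷ 1+a<N ∷ [])))))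
    where
    a<N : a < N
    a<N = <-trans (n<1+n a) 1+a<N

module Collapse (N n : ℕ) where
  open Staircase {M (suc N) n} N (λ k → estar (suc k)) estar-comm estar-braid public

  segment≡estarSegLen : ∀ a m B → segment a m B ≡ estarSegLen (suc a) m B
  segment≡estarSegLen a zero    B = refl
  segment≡estarSegLen a (suc m) B = segment≡estarSegLen a m (estar (suc (a + m)) B)

  rhoAux≡growing : ∀ m B → rhoAux m B ≡ growing 0 m B
  rhoAux≡growing zero    B = refl
  rhoAux≡growing (suc m) B = trans
    (cong (estarSegLen 1 (suc m)) (rhoAux≡growing m B))
    (sym (segment≡estarSegLen 0 (suc m) (growing 0 m B)))

  rhsAux≡shrinking : ∀ a m B → rhsAux (suc a) m B ≡ shrinking a m B
  rhsAux≡shrinking a zero    B = refl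
  rhsAux≡shrinking a (suc m) B = trans
    (rhsAux≡shrinking (suc a) m _)
    (cong (shrinking (suc a) m) (sym (segment≡estarSegLen a (N ∸ a) B)))

rhoN≡rhsN : ∀ {L n} (B : M L n) → rhoN B ≡ rhsN B
rhoN≡rhsN {zero}      B = refl
rhoN≡rhsN {suc N} {n} B = begin
  rhoAux N B       ≡⟨ rhoAux≡growing N B ⟩
  growing 0 N B    ≡⟨ shrinking≡growing 0 N B refl ⟨
  shrinking 0 N B  ≡⟨ rhsAux≡shrinking 0 N B ⟨
  rhsAux 1 N B     ∎
  where
  open Collapse N n
  open ≡-Reasoning

lemma4p13 : (L n : ℕ) → L ≥ 1 → n ≥ 1 → (B : M L n) → rhoN B ≡ rhsN B
lemma4p13 L n _ _ B = rhoN≡rhsN B
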